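{- Fix integers $n,a\ge1$, and let $x,y$ be signed permutations of $n$. The matrix $K(x,y):=$ coefficient of $y$ in $\frac1{a^n}\tau^+_a(x)$ (resp. $\frac1{a^n}\tau^-_a(x)$) is the transition matrix of the following card shuffle on decks of $n$ distinct cards with orientation: (1) choose a weak-composition $(d_1,\dots,d_a)$ of $n$ with probability $\frac1{a^n}\binom{n}{d_1\,\cdots\,d_a}$; (2) cut the deck into $a$ piles, the $i$-th containing $d_i$ cards (the top $d_1$ cards form pile 1, etc.); (3) rotate the first, third, fifth, ... piles (resp. the second, fourth, sixth, ... piles) by 180 degrees; (4) choose uniformly one of the $\binom{n}{d_1\,\cdots\,d_a}$ interleavings of the $a$ piles. If $\tilde\tau$ is used in place of $\tau$, then the same holds with step (3) flipping the piles upside down instead of rotating them.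
   Context: A deck of $n$ cards is encoded by a signed permutation of $n$: a word $w_1\cdots w_n$ (card $w_1$ on top) in which for each $i\le n$ exactly one of $i,\bar i$ appears exactly once; $\bar i$ means card $i$ rotated by $180^\circ$ (for $\tau$) or flipped face-down (for $\tilde\tau$). Signed shuffle algebra on $\mathcal A=\{1,\dots,N,\bar1,\dots,\bar N\}$ ($N\ge n$): basis all words, product = sum of all interleavings, coproduct deconcatenation; $m$ iterated product, $\Delta^{[a]}$ iterated coproduct. $\tau(w_1\cdots w_n)=\tau(w_1)\cdots\tau(w_n)$ (rotation: signs change, order kept), $\tilde\tau(w_1\cdots w_n)=\tilde\tau(w_n)\cdots\tilde\tau(w_1)$ (flip: signs change, order reversed), with $i\leftrightarrow\bar i$ on letters. For $\theta\in\{\tau,\tilde\tau\}$, $\theta^+_a=m\circ(\mathrm{id}\otimes\theta\otimes\mathrm{id}\otimes\cdots)\circ\Delta^{[a]}$ and $\theta^-_a=m\circ(\theta\otimes\mathrm{id}\otimes\theta\otimes\cdots)\circ\Delta^{[a]}$ ($a$ alternating factors, starting with $\mathrm{id}$, resp. $\theta$). -}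

module Defs where

open import Data.Nat as ℕ using (ℕ; zero; suc; _+_; _*_; _^_; _<_; _!; _≡ᵇ_; NonZero)
open import Data.Nat.Properties using (_!≢0; m*n≢0; m^n≢0)
open import Data.Bool using (Bool; true; false; not; if_then_else_; _∧_)
open import Data.Fin using (Fin; toℕ)
open import Data.Product using (_×_; _,_; proj₁; proj₂)
open import Data.List as L using (List; []; _∷_; _++_; map; concatMap; filterᵇ; length; reverse; take; drop; upTo; allFin; foldr)
open import Data.List.Relation.Unary.All using (All)
open import Data.Vec as V using (Vec; []; _∷_)
open import Data.Integer using (+_)
open import Data.Rational as Q using (ℚ; 0ℚ)
open import Relation.Binary.PropositionalEquality using (_≡_)

-- Alphabet A = {1..N, 1̄..N̄}.  The letter (i , false) stands for the
-- card  toℕ i + 1  (upright), (i , true) for its barred version.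

Letter : ℕ → Set
Letter N = Fin N × Bool

Word : ℕ → Set
Word N = List (Letter N)

bar : ∀ {N} → Letter N → Letter N
bar (i , b) = (i , not b)

τ : ∀ {N} → Word N → Word N
τ w = map bar w

τ̃ : ∀ {N} → Word N → Word N
τ̃ w = reverse (map bar w)

data Orient : Set where
  rotation flip : Orient

θ : ∀ {N} → Orient → Word N → Word N
θ rotation = τ
θ flip     = τ̃

_≡L_ : ∀ {N} → Letter N → Letter N → Bool
(i , b) ≡L (j , c) = (toℕ i ≡ᵇ toℕ j) ∧ (if b then c else not c)

_≡W_ : ∀ {N} → Word N → Word N → Bool
[]      ≡W []      = true
[]      ≡W (_ ∷ _) = false
(_ ∷ _) ≡W []      = false
(x ∷ u) ≡W (y ∷ v) = (x ≡L y) ∧ (u ≡W v)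

cardCount : ∀ {N} → Fin N → Word N → ℕ
cardCount i w = length (filterᵇ (λ l → toℕ (proj₁ l) ≡ᵇ toℕ i) w)

IsSignedPerm : ∀ {N} → ℕ → Word N → Set
IsSignedPerm {N} n w =
  All (λ l → toℕ (proj₁ l) < n) w × (∀ (i : Fin N) → toℕ i < n → cardCount i w ≡ 1)

-- Signed shuffle algebra.  An element with ℕ coefficients is represented
-- as a formal sum: a list of words (with multiplicity).

sh : ∀ {N} → Word N → Word N → List (Word N)
sh []      v       = v ∷ []
sh (x ∷ u) []      = (x ∷ u) ∷ []
sh (x ∷ u) (y ∷ v) = map (x ∷_) (sh u (y ∷ v)) ++ map (y ∷_) (sh (x ∷ u) v)

-- iterated product m : A^{⊗k} → A  on a pure tensor
mProd : ∀ {N k} → Vec (Word N) k → List (Word N)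
mProd []       = [] ∷ []
mProd (u ∷ us) = concatMap (sh u) (mProd us)

-- iterated coproduct Δ^[k] (deconcatenation into k possibly empty pieces)
deconcat : ∀ {N} (k : ℕ) → Word N → List (Vec (Word N) k)
deconcat zero    []      = [] ∷ []
deconcat zero    (_ ∷ _) = []
deconcat (suc k) w =
  concatMap (λ i → map (take i w ∷_) (deconcat k (drop i w))) (upTo (suc (length w)))

altMap : ∀ {N k} → Bool → (Word N → Word N) → Vec (Word N) k → Vec (Word N) k
altMap b f []       = []
altMap b f (u ∷ us) = (if b then f u else u) ∷ altMap (not b) f us

data Sign : Set where
  plus minus : Sign

startsWithθ : Sign → Bool
startsWithθ plus  = false
startsWithθ minus = true

-- θ^±_a (x) = m ∘ (alternating id / θ) ∘ Δ^[a] (x)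
θPow : ∀ {N} → Orient → Sign → (a : ℕ) → Word N → List (Word N)
θPow o s a x = concatMap (λ v → mProd (altMap (startsWithθ s) (θ o) v)) (deconcat a x)

coeff : ∀ {N} → Word N → List (Word N) → ℕ
coeff y ws = length (filterᵇ (λ w → w ≡W y) ws)

K : ∀ {N} → Orient → Sign → (n a : ℕ) .{{_ : NonZero a}} → Word N → Word N → ℚ
K o s n a x y = _/_ (+ coeff y (θPow o s a x)) (a ^ n) {{m^n≢0 a n}}
  where open Q using (_/_)

Dist : Set → Set
Dist A = List (A × ℚ)

probOf : ∀ {N} → Dist (Word N) → Word N → ℚ
probOf D y = foldr (λ p acc → (if proj₁ p ≡W y then proj₂ p else 0ℚ) Q.+ acc) 0ℚ D

uniform : ∀ {A : Set} → List A → Dist A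
uniform []       = []
uniform (x ∷ xs) = map (λ z → z , Q._/_ (+ 1) (suc (length xs))) (x ∷ xs)

allVecs : (a n : ℕ) → List (Vec ℕ a)
allVecs zero    n = [] ∷ []
allVecs (suc a) n = concatMap (λ d → map (d ∷_) (allVecs a n)) (upTo (suc n))

weakComps : (a n : ℕ) → List (Vec ℕ a)
weakComps a n = filterᵇ (λ d → V.sum d ≡ᵇ n) (allVecs a n)

prodFact : ∀ {a} → Vec ℕ a → ℕ
prodFact []       = 1
prodFact (d ∷ ds) = d ! * prodFact ds

prodFact-nz : ∀ {a} (d : Vec ℕ a) → NonZero (prodFact d)
prodFact-nz []       = _
prodFact-nz (d ∷ ds) = m*n≢0 (d !) (prodFact ds) {{d !≢0}} {{prodFact-nz ds}}

multinomial : ∀ {a} → ℕ → Vec ℕ a → ℚ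
multinomial n d = Q._/_ (+ (n !)) (prodFact d) {{prodFact-nz d}}

compProb : (n a : ℕ) .{{_ : NonZero a}} → Vec ℕ a → ℚ
compProb n a d = Q._/_ (+ 1) (a ^ n) {{m^n≢0 a n}} Q.* multinomial n d

-- step (2): cut the deck (top card first) into piles of sizes d₁,…,d_a
cut : ∀ {N k} → Word N → Vec ℕ k → Vec (Word N) k
cut w []       = []
cut w (d ∷ ds) = take d w ∷ cut (drop d w) ds

data Piles : Set where
  oddPiles  : Piles
  evenPiles : Piles

isEven : ℕ → Bool
isEven zero    = true
isEven (suc m) = not (isEven m)

-- pile with 0-based index i is the (i+1)-st pile
selected : Piles → ℕ → Bool
selected oddPiles  i = isEven i
selected evenPiles i = not (isEven i)

transformPiles : ∀ {N k} → Piles → (Word N → Word N) → Vec (Word N) k → Vec (Word N) k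
transformPiles p f ps =
  V.tabulate (λ i → if selected p (toℕ i) then f (V.lookup ps i) else V.lookup ps i)

-- step (4): an interleaving of a piles of sizes d is a sequence of pile
-- labels containing label i exactly dᵢ times; the j-th card of the new
-- deck is the current top card of the pile named by the j-th label.
allSeqs : (a n : ℕ) → List (List (Fin a))
allSeqs a zero    = [] ∷ []
allSeqs a (suc n) = concatMap (λ i → map (i ∷_) (allSeqs a n)) (allFin a)

countLabel : ∀ {a} → Fin a → List (Fin a) → ℕ
countLabel i s = length (filterᵇ (λ j → toℕ j ≡ᵇ toℕ i) s)

interleavings : ∀ {a} (n : ℕ) → Vec ℕ a → List (List (Fin a))
interleavings {a} n d =
  filterᵇ (λ s → foldr (λ i b → (countLabel i s ≡ᵇ V.lookup d i) ∧ b) true (allFin a))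
          (allSeqs a n)

merge : ∀ {N a} → Vec (Word N) a → List (Fin a) → Word N
merge ps []      = []
merge ps (i ∷ s) = take 1 (V.lookup ps i) ++ merge (ps V.[ i ]%= drop 1) s

shuffleDist : ∀ {N} → Orient → Piles → (n a : ℕ) .{{_ : NonZero a}} → Word N → Dist (Word N)
shuffleDist o p n a x =
  concatMap
    (λ d → map (λ r → proj₁ r , compProb n a d Q.* proj₂ r)
               (uniform (map (merge (transformPiles p (θ o) (cut x d))) (interleavings n d))))
    (weakComps a n)

shuffleProb : ∀ {N} → Orient → Piles → (n a : ℕ) .{{_ : NonZero a}} → Word N → Word N → ℚ
shuffleProb o p n a x y = probOf (shuffleDist o p n a x) y

-- Pairing of θ^± with the pile parity:
-- θ⁺ applies id to the 1st tensor factor (= top pile) and θ to the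
-- 2nd, 4th, ...; θ⁻ applies θ to the 1st, 3rd, ... factors.
pilesOf : Sign → Piles
pilesOf plus  = evenPiles
pilesOf minus = oddPiles

module Submission where

-- Expanding Δ^[a] x into its deconcatenations, the terms of θ^±_a(x) are indexed by the
-- weak compositions d of n: cutting x according to d and applying θ to alternate piles
-- gives exactly the piles of steps (2)–(3), and the term is their shuffle product.  The
-- shuffle product of piles and the list of their merges along label sequences with label
-- counts d obey the same recursion on the first letter, so they agree as multisets; in
-- particular there are n!/∏ dᵢ! of them.  So the coefficient of y counts, over all d, the
-- interleavings producing y, while the shuffle gives each such interleaving probability
-- (n!/(aⁿ ∏ dᵢ!)) · (∏ dᵢ!/n!) = 1/aⁿ.

open import Defs
open import Data.Nat using (ℕ; _≤_; NonZero)
open import Relation.Binary.PropositionalEquality using (_≡_)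

open import Data.Nat using (zero; suc; pred; _+_; _*_; _^_; _∸_; _<_; _!; _≡ᵇ_; _<ᵇ_; z≤n; s≤s)
import Data.Nat.Properties as ℕ
open import Data.Nat.Tactic.RingSolver using (solve-∀)
open import Algebra.Properties.CommutativeSemigroup ℕ.+-commutativeSemigroup using (interchange)
open import Algebra.Properties.Monoid.Sum ℕ.+-0-monoid using (sum-syntax; sum-cong-≗; sum-replicate-zero)
import Data.Integer as ℤ
import Data.Integer.Properties as ℤ
import Data.Integer.Tactic.RingSolver as ℤSolver
open import Data.Rational as ℚ using (ℚ; 0ℚ; toℚᵘ)
import Data.Rational.Properties as ℚ
open import Data.Rational.Unnormalised as ℚᵘ using (mkℚᵘ; *≡*) renaming (_≃_ to _≃ᵘ_)
import Data.Rational.Unnormalised.Properties as ℚᵘ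
open import Data.Bool using (Bool; true; false; not; if_then_else_; _∧_; T)
open import Data.Bool.Properties using (∧-zeroʳ; not-involutive; T-≡)
open import Data.Fin as Fin using (Fin; toℕ)
open import Data.Fin.Properties using (toℕ-injective; toℕ-fromℕ<)
open import Data.Product using (_×_; _,_; proj₁; proj₂)
open import Data.List using (List; []; _∷_; _++_; map; concatMap; filterᵇ; foldr; length; take; drop; upTo; applyUpTo; allFin; tabulate)
import Data.List.Properties as List
open import Data.List.Relation.Unary.All as All using (All; []; _∷_)
import Data.List.Relation.Unary.All.Properties as All
open import Data.List.Relation.Unary.Any using (here; there)
open import Data.List.Membership.Propositional using (_∈_)
open import Data.List.Membership.Propositional.Properties using (∈-allFin)
open import Data.Vec as Vec using (Vec; []; _∷_; lookup; _[_]%=_)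
import Data.Vec.Properties as Vec
open import Function using (_∘_)
open import Function.Bundles using (Equivalence)
open import Relation.Binary.PropositionalEquality
  using (_≢_; refl; sym; trans; cong; cong₂; subst; subst₂; module ≡-Reasoning)
open import Relation.Nullary using (yes; no; contradiction)
open import Relation.Nullary.Decidable using (T?)

∑ : {A : Set} → (A → ℕ) → List A → ℕ
∑ f []       = 0
∑ f (x ∷ xs) = f x + ∑ f xs

module _ {A : Set} where

  ∑-cong : {f g : A → ℕ} → (∀ x → f x ≡ g x) → ∀ xs → ∑ f xs ≡ ∑ g xs
  ∑-cong f≗g []       = refl
  ∑-cong f≗g (x ∷ xs) = cong₂ _+_ (f≗g x) (∑-cong f≗g xs)

  ∑-cong-All : {f g : A → ℕ} {xs : List A} → All (λ x → f x ≡ g x) xs → ∑ f xs ≡ ∑ g xs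
  ∑-cong-All []         = refl
  ∑-cong-All (eq ∷ eqs) = cong₂ _+_ eq (∑-cong-All eqs)

  ∑-zero : {f : A → ℕ} → (∀ x → f x ≡ 0) → ∀ xs → ∑ f xs ≡ 0
  ∑-zero f≗0 []       = refl
  ∑-zero f≗0 (x ∷ xs) = cong₂ _+_ (f≗0 x) (∑-zero f≗0 xs)

  ∑-const : ∀ c (xs : List A) → ∑ (λ _ → c) xs ≡ length xs * c
  ∑-const c []       = refl
  ∑-const c (x ∷ xs) = cong (c +_) (∑-const c xs)

  length≡∑1 : (xs : List A) → length xs ≡ ∑ (λ _ → 1) xs
  length≡∑1 []       = refl
  length≡∑1 (x ∷ xs) = cong suc (length≡∑1 xs)

  ∑-+ : ∀ (f g : A → ℕ) xs → ∑ (λ x → f x + g x) xs ≡ ∑ f xs + ∑ g xs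
  ∑-+ f g []       = refl
  ∑-+ f g (x ∷ xs) = trans (cong (f x + g x +_) (∑-+ f g xs)) (interchange (f x) (g x) _ _)

  ∑-++ : ∀ (f : A → ℕ) xs ys → ∑ f (xs ++ ys) ≡ ∑ f xs + ∑ f ys
  ∑-++ f []       ys = refl
  ∑-++ f (x ∷ xs) ys = trans (cong (f x +_) (∑-++ f xs ys)) (sym (ℕ.+-assoc (f x) _ _))

  ∑-filterᵇ : ∀ (f : A → ℕ) p xs → ∑ f (filterᵇ p xs) ≡ ∑ (λ x → if p x then f x else 0) xs
  ∑-filterᵇ f p []       = refl
  ∑-filterᵇ f p (x ∷ xs) with p x
  ... | true  = cong (f x +_) (∑-filterᵇ f p xs)
  ... | false = ∑-filterᵇ f p xs

module _ {A B : Set} where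

  ∑-map : ∀ (f : B → ℕ) (g : A → B) xs → ∑ f (map g xs) ≡ ∑ (f ∘ g) xs
  ∑-map f g []       = refl
  ∑-map f g (x ∷ xs) = cong (f (g x) +_) (∑-map f g xs)

  ∑-concatMap : ∀ (f : B → ℕ) (g : A → List B) xs → ∑ f (concatMap g xs) ≡ ∑ (λ x → ∑ f (g x)) xs
  ∑-concatMap f g []       = refl
  ∑-concatMap f g (x ∷ xs) = trans (∑-++ f (g x) (concatMap g xs)) (cong (∑ f (g x) +_) (∑-concatMap f g xs))

length-filterᵇ : {A : Set} (p : A → Bool) (xs : List A) → length (filterᵇ p xs) ≡ ∑ (λ x → if p x then 1 else 0) xs
length-filterᵇ p xs = trans (length≡∑1 (filterᵇ p xs)) (∑-filterᵇ (λ _ → 1) p xs)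

∑-tabulate : ∀ {A : Set} {k} (f : A → ℕ) (g : Fin k → A) → ∑ f (tabulate g) ≡ ∑[ i < k ] f (g i)
∑-tabulate {k = zero}  f g = refl
∑-tabulate {k = suc k} f g = cong (f (g Fin.zero) +_) (∑-tabulate f (g ∘ Fin.suc))

-- The shuffle product, letter by letter

onHead : ∀ {N} → Word N → (Letter N → ℕ) → ℕ
onHead []      k = 0
onHead (c ∷ _) k = k c

onHead-cong : ∀ {N} (w : Word N) {k k′ : Letter N → ℕ} → (∀ c → k c ≡ k′ c) → onHead w k ≡ onHead w k′
onHead-cong []      k≗k′ = refl
onHead-cong (c ∷ w) k≗k′ = k≗k′ c

ifAllEmpty : ∀ {N k} → Vec (Word N) k → ℕ → ℕ
ifAllEmpty []             x = x
ifAllEmpty ([] ∷ ps)      x = ifAllEmpty ps x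
ifAllEmpty ((_ ∷ _) ∷ ps) x = 0

ifAllEmpty-0 : ∀ {N k} (ps : Vec (Word N) k) → ifAllEmpty ps 0 ≡ 0
ifAllEmpty-0 []             = refl
ifAllEmpty-0 ([] ∷ ps)      = ifAllEmpty-0 ps
ifAllEmpty-0 ((_ ∷ _) ∷ ps) = refl

sh-[] : ∀ {N} (u : Word N) → sh u [] ≡ u ∷ []
sh-[] []      = refl
sh-[] (x ∷ u) = refl

∑-sh : ∀ {N} (h : Word N → ℕ) (u w : Word N) →
  ∑ h (sh u w) ≡ ifAllEmpty (u ∷ w ∷ []) (h [])
               + onHead u (λ c → ∑ (h ∘ (c ∷_)) (sh (drop 1 u) w))
               + onHead w (λ c → ∑ (h ∘ (c ∷_)) (sh u (drop 1 w)))
∑-sh h []      []      = sym (ℕ.+-identityʳ _)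
∑-sh h []      (z ∷ w) = refl
∑-sh h (x ∷ u) []      = sym (trans (ℕ.+-identityʳ _) (cong (∑ (h ∘ (x ∷_))) (sh-[] u)))
∑-sh h (x ∷ u) (z ∷ w) =
  trans (∑-++ h (map (x ∷_) (sh u (z ∷ w))) (map (z ∷_) (sh (x ∷ u) w)))
        (cong₂ _+_ (∑-map h (x ∷_) (sh u (z ∷ w))) (∑-map h (z ∷_) (sh (x ∷ u) w)))

byFirstLetter : ∀ {N k} → Vec (Word N) k → (Word N → ℕ) → ℕ
byFirstLetter {k = k} ps h =
  ∑[ i < k ] onHead (lookup ps i) (λ c → ∑ (h ∘ (c ∷_)) (mProd (ps [ i ]%= drop 1)))

byFirstLetter-0 : ∀ {N k} (ps : Vec (Word N) k) (h : Word N → ℕ) → (∀ c w → h (c ∷ w) ≡ 0) →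
  byFirstLetter ps h ≡ 0
byFirstLetter-0 {k = k} ps h h∷≗0 =
  trans (sum-cong-≗ λ i → onHead≗0 (lookup ps i) (mProd (ps [ i ]%= drop 1))) (sum-replicate-zero k)
  where
  onHead≗0 : ∀ w ws → onHead w (λ c → ∑ (λ v → h (c ∷ v)) ws) ≡ 0
  onHead≗0 []      ws = refl
  onHead≗0 (c ∷ _) ws = ∑-zero (h∷≗0 c) ws

∑-mProd : ∀ {N k} (ps : Vec (Word N) k) (h : Word N → ℕ) →
  ∑ h (mProd ps) ≡ ifAllEmpty ps (h []) + byFirstLetter ps h
∑-mProd []       h = refl
∑-mProd {N} {suc k} (u ∷ us) h = begin
  ∑ h (mProd (u ∷ us))
    ≡⟨ ∑-concatMap h (sh u) (mProd us) ⟩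
  ∑ (λ w → ∑ h (sh u w)) (mProd us)
    ≡⟨ ∑-cong (∑-sh h u) (mProd us) ⟩
  ∑ (λ w → g₁ u w + g₂ u w + g₃ w) (mProd us)
    ≡⟨ trans (∑-+ _ g₃ (mProd us)) (cong (_+ ∑ g₃ (mProd us)) (∑-+ (g₁ u) (g₂ u) (mProd us))) ⟩
  ∑ (g₁ u) (mProd us) + ∑ (g₂ u) (mProd us) + ∑ g₃ (mProd us)
    ≡⟨ cong₂ _+_ (cong₂ _+_ (bothEmpty u) (firstPile u)) laterPiles ⟩
  ifAllEmpty (u ∷ us) (h []) + onHead u (λ c → ∑ (h ∘ (c ∷_)) (mProd (drop 1 u ∷ us)))
    + ∑[ j < k ] onHead (lookup us j) (λ c → ∑ (h ∘ (c ∷_)) (mProd (u ∷ (us [ j ]%= drop 1))))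
    ≡⟨ ℕ.+-assoc (ifAllEmpty (u ∷ us) (h [])) _ _ ⟩
  ifAllEmpty (u ∷ us) (h []) + byFirstLetter (u ∷ us) h
    ∎
  where
  open ≡-Reasoning
  g₁ g₂ : Word N → Word N → ℕ
  g₁ v w = ifAllEmpty (v ∷ w ∷ []) (h [])
  g₂ v w = onHead v (λ c → ∑ (h ∘ (c ∷_)) (sh (drop 1 v) w))
  g₃ : Word N → ℕ
  g₃ w = onHead w (λ c → ∑ (h ∘ (c ∷_)) (sh u (drop 1 w)))

  bothEmpty : ∀ v → ∑ (g₁ v) (mProd us) ≡ ifAllEmpty (v ∷ us) (h [])
  bothEmpty []      = trans (∑-mProd us (g₁ []))
                            (trans (cong (ifAllEmpty us (h []) +_) (byFirstLetter-0 us (g₁ []) (λ _ _ → refl)))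
                                   (ℕ.+-identityʳ _))
  bothEmpty (_ ∷ _) = trans (∑-mProd us (λ _ → 0))
                            (cong₂ _+_ (ifAllEmpty-0 us) (byFirstLetter-0 us (λ _ → 0) (λ _ _ → refl)))

  firstPile : ∀ v → ∑ (g₂ v) (mProd us) ≡ onHead v (λ c → ∑ (h ∘ (c ∷_)) (mProd (drop 1 v ∷ us)))
  firstPile []      = ∑-zero (λ _ → refl) (mProd us)
  firstPile (c ∷ v) = sym (∑-concatMap (h ∘ (c ∷_)) (sh v) (mProd us))

  laterPiles : ∑ g₃ (mProd us)
             ≡ ∑[ j < k ] onHead (lookup us j) (λ c → ∑ (h ∘ (c ∷_)) (mProd (u ∷ (us [ j ]%= drop 1))))
  laterPiles =
    trans (∑-mProd us g₃)
    (trans (cong (_+ byFirstLetter us g₃) (ifAllEmpty-0 us))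
           (sum-cong-≗ λ j → onHead-cong (lookup us j) λ c →
              sym (∑-concatMap (h ∘ (c ∷_)) (sh u) (mProd (us [ j ]%= drop 1)))))

-- Interleavings as label sequences

allᵇ : {A : Set} → (A → Bool) → List A → Bool
allᵇ p xs = foldr (λ x b → p x ∧ b) true xs

module _ {A : Set} where

  allᵇ-cong : {p q : A → Bool} → (∀ x → p x ≡ q x) → ∀ xs → allᵇ p xs ≡ allᵇ q xs
  allᵇ-cong p≗q []       = refl
  allᵇ-cong p≗q (x ∷ xs) = cong₂ _∧_ (p≗q x) (allᵇ-cong p≗q xs)

  allᵇ-true : {p : A → Bool} → (∀ x → p x ≡ true) → ∀ xs → allᵇ p xs ≡ true
  allᵇ-true p≗true []       = refl
  allᵇ-true p≗true (x ∷ xs) = cong₂ _∧_ (p≗true x) (allᵇ-true p≗true xs)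

  allᵇ-false : {p : A → Bool} {x : A} {xs : List A} → x ∈ xs → p x ≡ false → allᵇ p xs ≡ false
  allᵇ-false {p = p} {xs = y ∷ ys} (here refl) px≡false = cong (_∧ allᵇ p ys) px≡false
  allᵇ-false {p = p} {xs = y ∷ ys} (there x∈ys) px≡false =
    trans (cong (p y ∧_) (allᵇ-false x∈ys px≡false)) (∧-zeroʳ (p y))

-- The filter predicate of interleavings, so that filterᵇ (hasLabelCounts d) (allSeqs a n)
-- is interleavings n d by definition.
hasLabelCounts : ∀ {a} → Vec ℕ a → List (Fin a) → Bool
hasLabelCounts {a} d s = allᵇ (λ i → countLabel i s ≡ᵇ lookup d i) (allFin a)

≡ᵇ-refl : ∀ n → (n ≡ᵇ n) ≡ true
≡ᵇ-refl zero    = refl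
≡ᵇ-refl (suc n) = ≡ᵇ-refl n

countLabel-here : ∀ {a} (i : Fin a) s → countLabel i (i ∷ s) ≡ suc (countLabel i s)
countLabel-here i s rewrite ≡ᵇ-refl (toℕ i) = refl

countLabel-there : ∀ {a} {i j : Fin a} s → j ≢ i → countLabel j (i ∷ s) ≡ countLabel j s
countLabel-there {i = i} {j} s j≢i with toℕ i ≡ᵇ toℕ j in eq
... | false = refl
... | true  = contradiction (sym (toℕ-injective (ℕ.≡ᵇ⇒≡ _ _ (subst T (sym eq) _)))) j≢i

hasLabelCounts-∷ : ∀ {a} (d : Vec ℕ a) (i : Fin a) {x} s → lookup d i ≡ suc x →
  hasLabelCounts d (i ∷ s) ≡ hasLabelCounts (d [ i ]%= pred) s
hasLabelCounts-∷ d i s dᵢ≡1+x = allᵇ-cong countsAgree (allFin _)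
  where
  countsAgree : ∀ j → (countLabel j (i ∷ s) ≡ᵇ lookup d j) ≡ (countLabel j s ≡ᵇ lookup (d [ i ]%= pred) j)
  countsAgree j with j Fin.≟ i
  ... | yes refl rewrite countLabel-here i s | Vec.lookup∘updateAt i {pred} d | dᵢ≡1+x = refl
  ... | no j≢i  rewrite countLabel-there s j≢i | Vec.lookup∘updateAt′ j i {pred} j≢i d = refl

hasLabelCounts-∷-0 : ∀ {a} (d : Vec ℕ a) (i : Fin a) s → lookup d i ≡ 0 → hasLabelCounts d (i ∷ s) ≡ false
hasLabelCounts-∷-0 d i s dᵢ≡0 = allᵇ-false (∈-allFin i) (cong₂ _≡ᵇ_ (countLabel-here i s) dᵢ≡0)

hasLabelCounts-[] : ∀ {a} (d : Vec ℕ a) → (∀ i → lookup d i ≡ 0) → hasLabelCounts d [] ≡ true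
hasLabelCounts-[] d d≗0 = allᵇ-true (λ i → cong (0 ≡ᵇ_) (d≗0 i)) (allFin _)

lengths : ∀ {N k} → Vec (Word N) k → Vec ℕ k
lengths = Vec.map length

lengths-dropHead : ∀ {N k} (ps : Vec (Word N) k) i → lengths (ps [ i ]%= drop 1) ≡ lengths ps [ i ]%= pred
lengths-dropHead ps i = Vec.map-updateAt ps i (length-drop1 (lookup ps i))
  where
  length-drop1 : ∀ {N} (w : Word N) → length (drop 1 w) ≡ pred (length w)
  length-drop1 []      = refl
  length-drop1 (_ ∷ _) = refl

sum-updateAt-pred : ∀ {k} (d : Vec ℕ k) i {x} → lookup d i ≡ suc x → Vec.sum d ≡ suc (Vec.sum (d [ i ]%= pred))
sum-updateAt-pred (dᵢ ∷ d) Fin.zero    refl = refl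
sum-updateAt-pred (d₀ ∷ d) (Fin.suc i) eq   =
  trans (cong (d₀ +_) (sum-updateAt-pred d i eq)) (ℕ.+-suc d₀ _)

lookup-empty : ∀ {N k} (ps : Vec (Word N) k) → Vec.sum (lengths ps) ≡ 0 → ∀ i → lookup ps i ≡ []
lookup-empty ([] ∷ ps) total≡0 Fin.zero    = refl
lookup-empty (p ∷ ps)  total≡0 (Fin.suc i) = lookup-empty ps (ℕ.m+n≡0⇒n≡0 (length p) total≡0) i

ifAllEmpty-empty : ∀ {N k} (ps : Vec (Word N) k) {x} → Vec.sum (lengths ps) ≡ 0 → ifAllEmpty ps x ≡ x
ifAllEmpty-empty []        total≡0 = refl
ifAllEmpty-empty ([] ∷ ps) total≡0 = ifAllEmpty-empty ps total≡0

ifAllEmpty-nonempty : ∀ {N k} (ps : Vec (Word N) k) {x m} → Vec.sum (lengths ps) ≡ suc m → ifAllEmpty ps x ≡ 0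
ifAllEmpty-nonempty ([] ∷ ps)      total≡1+m = ifAllEmpty-nonempty ps total≡1+m
ifAllEmpty-nonempty ((_ ∷ _) ∷ ps) total≡1+m = refl

byFirstLetter-empty : ∀ {N k} (ps : Vec (Word N) k) (h : Word N → ℕ) → (∀ i → lookup ps i ≡ []) →
  byFirstLetter ps h ≡ 0
byFirstLetter-empty {k = k} ps h ps≗[] = trans (sum-cong-≗ λ i → onHead-[] (ps≗[] i)) (sum-replicate-zero k)
  where
  onHead-[] : ∀ {w : Word _} {f} → w ≡ [] → onHead w f ≡ 0
  onHead-[] refl = refl

∑-allSeqs-suc : ∀ {a} m (f : List (Fin a) → ℕ) → ∑ f (allSeqs a (suc m)) ≡ ∑[ i < a ] ∑ (f ∘ (i ∷_)) (allSeqs a m)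
∑-allSeqs-suc {a} m f =
  trans (∑-concatMap f (λ i → map (i ∷_) (allSeqs a m)) (allFin a))
  (trans (∑-cong (λ i → ∑-map f (i ∷_) (allSeqs a m)) (allFin a))
         (∑-tabulate (λ i → ∑ (f ∘ (i ∷_)) (allSeqs a m)) (λ i → i)))

∑-merge-hasLabelCounts : ∀ {N a} m (ps : Vec (Word N) a) (h : Word N → ℕ) → Vec.sum (lengths ps) ≡ m →
  ∑ (λ s → if hasLabelCounts (lengths ps) s then h (merge ps s) else 0) (allSeqs a m) ≡ ∑ h (mProd ps)
∑-merge-hasLabelCounts zero ps h total≡0 = begin
  (if hasLabelCounts (lengths ps) [] then h [] else 0) + 0
    ≡⟨ cong (λ b → (if b then h [] else 0) + 0) (hasLabelCounts-[] (lengths ps) lengths≗0) ⟩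
  h [] + 0
    ≡⟨ cong₂ _+_ (sym (ifAllEmpty-empty ps total≡0)) (sym (byFirstLetter-empty ps h (lookup-empty ps total≡0))) ⟩
  ifAllEmpty ps (h []) + byFirstLetter ps h
    ≡⟨ sym (∑-mProd ps h) ⟩
  ∑ h (mProd ps)
    ∎
  where
  open ≡-Reasoning
  lengths≗0 : ∀ i → lookup (lengths ps) i ≡ 0
  lengths≗0 i = trans (Vec.lookup-map i length ps) (cong length (lookup-empty ps total≡0 i))
∑-merge-hasLabelCounts {a = a} (suc m) ps h total≡1+m = begin
  ∑ f (allSeqs a (suc m))
    ≡⟨ ∑-allSeqs-suc m f ⟩
  ∑[ i < a ] ∑ (f ∘ (i ∷_)) (allSeqs a m)
    ≡⟨ sum-cong-≗ startingWith ⟩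
  byFirstLetter ps h
    ≡⟨ cong (_+ byFirstLetter ps h) (sym (ifAllEmpty-nonempty ps total≡1+m)) ⟩
  ifAllEmpty ps (h []) + byFirstLetter ps h
    ≡⟨ sym (∑-mProd ps h) ⟩
  ∑ h (mProd ps)
    ∎
  where
  open ≡-Reasoning
  f : List (Fin a) → ℕ
  f s = if hasLabelCounts (lengths ps) s then h (merge ps s) else 0

  lengthᵢ : ∀ {i w} → lookup ps i ≡ w → lookup (lengths ps) i ≡ length w
  lengthᵢ {i} psᵢ≡w = trans (Vec.lookup-map i length ps) (cong length psᵢ≡w)

  startingWith : ∀ i → ∑ (f ∘ (i ∷_)) (allSeqs a m)
                     ≡ onHead (lookup ps i) (λ c → ∑ (h ∘ (c ∷_)) (mProd (ps [ i ]%= drop 1)))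
  startingWith i with lookup ps i in psᵢ≡
  ... | [] = ∑-zero (λ s → cong (λ b → if b then h (merge (ps [ i ]%= drop 1) s) else 0)
                                (hasLabelCounts-∷-0 (lengths ps) i s (lengthᵢ psᵢ≡))) (allSeqs a m)
  ... | c ∷ r =
    trans (∑-cong (λ s → cong (λ b → if b then h (c ∷ merge ps′ s) else 0) (counts s)) (allSeqs a m))
          (∑-merge-hasLabelCounts m ps′ (h ∘ (c ∷_)) total′)
    where
    ps′ : Vec (Word _) a
    ps′ = ps [ i ]%= drop 1
    counts : ∀ s → hasLabelCounts (lengths ps) (i ∷ s) ≡ hasLabelCounts (lengths ps′) s
    counts s = trans (hasLabelCounts-∷ (lengths ps) i s (lengthᵢ psᵢ≡))
                     (cong (λ d → hasLabelCounts d s) (sym (lengths-dropHead ps i)))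
    total′ : Vec.sum (lengths ps′) ≡ m
    total′ = ℕ.suc-injective (trans (trans (cong (λ d → suc (Vec.sum d)) (lengths-dropHead ps i))
                                            (sym (sum-updateAt-pred (lengths ps) i (lengthᵢ psᵢ≡)))) total≡1+m)

∑-merge-interleavings : ∀ {N a} m (ps : Vec (Word N) a) (h : Word N → ℕ) → Vec.sum (lengths ps) ≡ m →
  ∑ h (map (merge ps) (interleavings m (lengths ps))) ≡ ∑ h (mProd ps)
∑-merge-interleavings {a = a} m ps h total≡m =
  trans (∑-map h (merge ps) (interleavings m (lengths ps)))
  (trans (∑-filterᵇ (h ∘ merge ps) (hasLabelCounts (lengths ps)) (allSeqs a m))
         (∑-merge-hasLabelCounts m ps h total≡m))

-- The number of shuffles

shuffleCount : ℕ → ℕ → ℕ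
shuffleCount zero    n       = 1
shuffleCount (suc m) zero    = 1
shuffleCount (suc m) (suc n) = shuffleCount m (suc n) + shuffleCount (suc m) n

shuffleCount-! : ∀ m n → shuffleCount m n * m ! * n ! ≡ (m + n) !
shuffleCount-! zero    n       = ℕ.+-identityʳ (n !)
shuffleCount-! (suc m) zero    = trans (ℕ.*-identityʳ _) (trans (ℕ.*-identityˡ _) (cong _! (sym (ℕ.+-identityʳ (suc m)))))
shuffleCount-! (suc m) (suc n) = begin
  (A + B) * suc m ! * suc n !
    ≡⟨ split A B (m !) (n !) m n ⟩
  suc m * (A * m ! * suc n !) + suc n * (B * suc m ! * n !)
    ≡⟨ cong₂ (λ x y → suc m * x + suc n * y) (shuffleCount-! m (suc n)) fromRight ⟩
  suc m * (m + suc n) ! + suc n * (m + suc n) !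
    ≡⟨ sym (ℕ.*-distribʳ-+ ((m + suc n) !) (suc m) (suc n)) ⟩
  (suc m + suc n) !
    ∎
  where
  open ≡-Reasoning
  A B : ℕ
  A = shuffleCount m (suc n)
  B = shuffleCount (suc m) n
  split : ∀ a b p q m n → (a + b) * (suc m * p) * (suc n * q) ≡ suc m * (a * p * (suc n * q)) + suc n * (b * (suc m * p) * q)
  split = solve-∀
  fromRight : B * suc m ! * n ! ≡ (m + suc n) !
  fromRight = trans (shuffleCount-! (suc m) n) (cong _! (sym (ℕ.+-suc m n)))

length-concatMap : {A B : Set} (g : A → List B) (xs : List A) → length (concatMap g xs) ≡ ∑ (length ∘ g) xs
length-concatMap g xs =
  trans (length≡∑1 (concatMap g xs)) (trans (∑-concatMap (λ _ → 1) g xs) (∑-cong (λ x → sym (length≡∑1 (g x))) xs))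

length-sh : ∀ {N} (u w : Word N) → length (sh u w) ≡ shuffleCount (length u) (length w)
length-sh []      w       = refl
length-sh (x ∷ u) []      = refl
length-sh (x ∷ u) (z ∷ w) = begin
  length (map (x ∷_) (sh u (z ∷ w)) ++ map (z ∷_) (sh (x ∷ u) w))
    ≡⟨ List.length-++ (map (x ∷_) (sh u (z ∷ w))) ⟩
  length (map (x ∷_) (sh u (z ∷ w))) + length (map (z ∷_) (sh (x ∷ u) w))
    ≡⟨ cong₂ _+_ (List.length-map (x ∷_) (sh u (z ∷ w))) (List.length-map (z ∷_) (sh (x ∷ u) w)) ⟩
  length (sh u (z ∷ w)) + length (sh (x ∷ u) w)
    ≡⟨ cong₂ _+_ (length-sh u (z ∷ w)) (length-sh (x ∷ u) w) ⟩
  shuffleCount (length (x ∷ u)) (length (z ∷ w))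
    ∎
  where open ≡-Reasoning

All-length-sh : ∀ {N} (u w : Word N) → All (λ v → length v ≡ length u + length w) (sh u w)
All-length-sh []      w       = refl ∷ []
All-length-sh (x ∷ u) []      = cong suc (sym (ℕ.+-identityʳ (length u))) ∷ []
All-length-sh (x ∷ u) (z ∷ w) =
  All.++⁺ (All.map⁺ (All.map (cong suc) (All-length-sh u (z ∷ w))))
          (All.map⁺ (All.map (λ eq → trans (cong suc eq) (sym (ℕ.+-suc (suc (length u)) (length w))))
                             (All-length-sh (x ∷ u) w)))

All-length-mProd : ∀ {N k} (ps : Vec (Word N) k) → All (λ v → length v ≡ Vec.sum (lengths ps)) (mProd ps)
All-length-mProd []       = refl ∷ []
All-length-mProd (u ∷ us) =
  All.concat⁺ (All.map⁺ (All.map (λ {w} eq → All.map (λ eq′ → trans eq′ (cong (length u +_) eq)) (All-length-sh u w))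
                                 (All-length-mProd us)))

length-mProd : ∀ {N k} (ps : Vec (Word N) k) → length (mProd ps) * prodFact (lengths ps) ≡ Vec.sum (lengths ps) !
length-mProd []       = refl
length-mProd (u ∷ us) = begin
  length (concatMap (sh u) (mProd us)) * (length u ! * prodFact (lengths us))
    ≡⟨ cong (_* (length u ! * prodFact (lengths us))) lengthProduct ⟩
  length (mProd us) * C * (length u ! * prodFact (lengths us))
    ≡⟨ rearrange (length (mProd us)) C (length u !) (prodFact (lengths us)) ⟩
  C * length u ! * (length (mProd us) * prodFact (lengths us))
    ≡⟨ cong (C * length u ! *_) (length-mProd us) ⟩
  C * length u ! * total !
    ≡⟨ shuffleCount-! (length u) total ⟩
  (length u + total) !
    ∎
  where
  open ≡-Reasoning
  total C : ℕ
  total = Vec.sum (lengths us)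
  C = shuffleCount (length u) total
  rearrange : ∀ l c f p → l * c * (f * p) ≡ c * f * (l * p)
  rearrange = solve-∀
  lengthProduct : length (concatMap (sh u) (mProd us)) ≡ length (mProd us) * C
  lengthProduct =
    trans (length-concatMap (sh u) (mProd us))
    (trans (∑-cong-All (All.map (λ {w} eq → trans (length-sh u w) (cong (shuffleCount (length u)) eq)) (All-length-mProd us)))
           (∑-const C (mProd us)))

-- Deconcatenations and weak compositions

+-≡ᵇ-∸ : ∀ {e n} s → e ≤ n → (e + s ≡ᵇ n) ≡ (s ≡ᵇ n ∸ e)
+-≡ᵇ-∸ s z≤n       = refl
+-≡ᵇ-∸ s (s≤s e≤n) = +-≡ᵇ-∸ s e≤n

+-≡ᵇ-false : ∀ {e n} s → n < e → (e + s ≡ᵇ n) ≡ false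
+-≡ᵇ-false {n = zero}  s (s≤s n<e) = refl
+-≡ᵇ-false {n = suc n} s (s≤s n<e) = +-≡ᵇ-false s n<e

∑-applyUpTo-truncate : ∀ {A : Set} (F : A → ℕ) (f : ℕ → A) {K M} → K ≤ M → (∀ e → K ≤ e → F (f e) ≡ 0) →
  ∑ F (applyUpTo f M) ≡ ∑ F (applyUpTo f K)
∑-applyUpTo-truncate F f {M = M} z≤n F≡0 =
  trans (∑-cong-All (All.applyUpTo⁺₂ f M (λ e → F≡0 e z≤n))) (∑-zero (λ _ → refl) (applyUpTo f M))
∑-applyUpTo-truncate F f (s≤s K≤M) F≡0 =
  cong (F (f 0) +_) (∑-applyUpTo-truncate F (f ∘ suc) K≤M (λ e K≤e → F≡0 (suc e) (s≤s K≤e)))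

∑-deconcat : ∀ {N} k (w : Word N) m (G : Vec (Word N) k → ℕ) → length w ≤ m →
  ∑ G (deconcat k w) ≡ ∑ (λ d → if Vec.sum d ≡ᵇ length w then G (cut w d) else 0) (allVecs k m)
∑-deconcat zero    []      m G _ = refl
∑-deconcat zero    (_ ∷ _) m G _ = refl
∑-deconcat (suc k) w m G |w|≤m = begin
  ∑ G (concatMap (λ i → map (take i w ∷_) (deconcat k (drop i w))) (upTo (suc (length w))))
    ≡⟨ ∑-concatMap G (λ i → map (take i w ∷_) (deconcat k (drop i w))) (upTo (suc (length w))) ⟩
  ∑ (λ i → ∑ G (map (take i w ∷_) (deconcat k (drop i w)))) (upTo (suc (length w)))
    ≡⟨ ∑-cong-All (All.map firstPile (All.all-upTo (suc (length w)))) ⟩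
  ∑ firstPileSum (upTo (suc (length w)))
    ≡⟨ sym (∑-applyUpTo-truncate firstPileSum (λ e → e) (s≤s |w|≤m) tooLong) ⟩
  ∑ firstPileSum (upTo (suc m))
    ≡⟨ sym (∑-cong (λ e → ∑-map f (e ∷_) (allVecs k m)) (upTo (suc m))) ⟩
  ∑ (λ e → ∑ f (map (e ∷_) (allVecs k m))) (upTo (suc m))
    ≡⟨ sym (∑-concatMap f (λ e → map (e ∷_) (allVecs k m)) (upTo (suc m))) ⟩
  ∑ f (allVecs (suc k) m)
    ∎
  where
  open ≡-Reasoning
  f : Vec ℕ (suc k) → ℕ
  f d = if Vec.sum d ≡ᵇ length w then G (cut w d) else 0
  firstPileSum : ℕ → ℕ
  firstPileSum e = ∑ (f ∘ (e ∷_)) (allVecs k m)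

  tooLong : ∀ e → suc (length w) ≤ e → firstPileSum e ≡ 0
  tooLong e |w|<e = ∑-zero (λ d → cong (λ b → if b then G (cut w (e ∷ d)) else 0) (+-≡ᵇ-false (Vec.sum d) |w|<e))
                           (allVecs k m)

  firstPile : ∀ {e} → e < suc (length w) → ∑ G (map (take e w ∷_) (deconcat k (drop e w))) ≡ firstPileSum e
  firstPile {e} (s≤s e≤|w|) = begin
    ∑ G (map (take e w ∷_) (deconcat k (drop e w)))
      ≡⟨ ∑-map G (take e w ∷_) (deconcat k (drop e w)) ⟩
    ∑ (G ∘ (take e w ∷_)) (deconcat k (drop e w))
      ≡⟨ ∑-deconcat k (drop e w) m (G ∘ (take e w ∷_)) |rest|≤m ⟩
    ∑ (λ d → if Vec.sum d ≡ᵇ length (drop e w) then G (cut w (e ∷ d)) else 0) (allVecs k m)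
      ≡⟨ ∑-cong (λ d → cong (λ b → if b then G (cut w (e ∷ d)) else 0) (restSum d)) (allVecs k m) ⟩
    firstPileSum e
      ∎
    where
    |rest|≤m : length (drop e w) ≤ m
    |rest|≤m = ℕ.≤-trans (ℕ.≤-reflexive (List.length-drop e w)) (ℕ.≤-trans (ℕ.m∸n≤m (length w) e) |w|≤m)
    restSum : ∀ d → (Vec.sum d ≡ᵇ length (drop e w)) ≡ (e + Vec.sum d ≡ᵇ length w)
    restSum d = trans (cong (Vec.sum d ≡ᵇ_) (List.length-drop e w)) (sym (+-≡ᵇ-∸ (Vec.sum d) e≤|w|))

oppositePiles : Piles → Piles
oppositePiles oddPiles  = evenPiles
oppositePiles evenPiles = oddPiles

not-selected-0 : ∀ p → not (selected p 0) ≡ selected (oppositePiles p) 0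
not-selected-0 oddPiles  = refl
not-selected-0 evenPiles = refl

selected-opposite : ∀ p t → selected (oppositePiles p) t ≡ selected p (suc t)
selected-opposite oddPiles  t = refl
selected-opposite evenPiles t = sym (not-involutive (isEven t))

altMap-transformPiles : ∀ {N k} p (f : Word N → Word N) (v : Vec (Word N) k) →
  altMap (selected p 0) f v ≡ transformPiles p f v
altMap-transformPiles p f []       = refl
altMap-transformPiles p f (u ∷ us) = cong (_ ∷_) (begin
  altMap (not (selected p 0)) f us
    ≡⟨ cong (λ b → altMap b f us) (not-selected-0 p) ⟩
  altMap (selected (oppositePiles p) 0) f us
    ≡⟨ altMap-transformPiles (oppositePiles p) f us ⟩
  transformPiles (oppositePiles p) f us
    ≡⟨ Vec.tabulate-cong (λ i → cong (λ b → if b then f (lookup us i) else lookup us i)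
                                     (selected-opposite p (toℕ i))) ⟩
  Vec.tabulate (λ i → if selected p (suc (toℕ i)) then f (lookup us i) else lookup us i)
    ∎)
  where open ≡-Reasoning

startsWithθ≡selected-0 : ∀ s → startsWithθ s ≡ selected (pilesOf s) 0
startsWithθ≡selected-0 plus  = refl
startsWithθ≡selected-0 minus = refl

θ-length : ∀ {N} o (w : Word N) → length (θ o w) ≡ length w
θ-length rotation w = List.length-map bar w
θ-length flip     w = trans (List.length-reverse (map bar w)) (List.length-map bar w)

lengths-altMap : ∀ {N k} b (f : Word N → Word N) → (∀ w → length (f w) ≡ length w) → (v : Vec (Word N) k) →
  lengths (altMap b f v) ≡ lengths v
lengths-altMap b     f f-length []       = refl
lengths-altMap true  f f-length (u ∷ us) = cong₂ _∷_ (f-length u) (lengths-altMap false f f-length us)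
lengths-altMap false f f-length (u ∷ us) = cong (length u ∷_) (lengths-altMap true f f-length us)

lengths-cut : ∀ {N k} (w : Word N) (d : Vec ℕ k) → Vec.sum d ≤ length w → lengths (cut w d) ≡ d
lengths-cut w []      _      = refl
lengths-cut w (e ∷ d) e+d≤|w| =
  cong₂ _∷_ (trans (List.length-take e w) (ℕ.m≤n⇒m⊓n≡m (ℕ.≤-trans (ℕ.m≤m+n e (Vec.sum d)) e+d≤|w|)))
            (lengths-cut (drop e w) d d≤|rest|)
  where
  d≤|rest| : Vec.sum d ≤ length (drop e w)
  d≤|rest| = subst₂ _≤_ (ℕ.m+n∸m≡n e (Vec.sum d)) (sym (List.length-drop e w)) (ℕ.∸-monoˡ-≤ e e+d≤|w|)

cardsBelow : ∀ {N} → ℕ → Word N → ℕ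
cardsBelow k w = ∑ (λ l → if toℕ (proj₁ l) <ᵇ k then 1 else 0) w

cardsBelow-suc : ∀ {N} k (w : Word N) →
  cardsBelow (suc k) w ≡ cardsBelow k w + length (filterᵇ (λ l → toℕ (proj₁ l) ≡ᵇ k) w)
cardsBelow-suc k w =
  trans (∑-cong (λ l → <ᵇ-suc (toℕ (proj₁ l)) k) w)
  (trans (∑-+ _ _ w) (cong (cardsBelow k w +_) (sym (length-filterᵇ _ w))))
  where
  <ᵇ-suc : ∀ x k → (if x <ᵇ suc k then 1 else 0) ≡ (if x <ᵇ k then 1 else 0) + (if x ≡ᵇ k then 1 else 0)
  <ᵇ-suc zero    zero    = refl
  <ᵇ-suc zero    (suc k) = refl
  <ᵇ-suc (suc x) zero    = refl
  <ᵇ-suc (suc x) (suc k) = <ᵇ-suc x k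

IsSignedPerm-length : ∀ {N} n (w : Word N) → n ≤ N → IsSignedPerm n w → length w ≡ n
IsSignedPerm-length {N} n w n≤N (cards<n , once) =
  trans (length≡∑1 w) (trans (∑-cong-All (All.map (λ {l} → below {l}) cards<n)) (cardsBelow-≤ n ℕ.≤-refl))
  where
  below : ∀ {l : Letter N} → toℕ (proj₁ l) < n → 1 ≡ (if toℕ (proj₁ l) <ᵇ n then 1 else 0)
  below lt = sym (cong (if_then 1 else 0) (Equivalence.to T-≡ (ℕ.<⇒<ᵇ lt)))
  onceEach : ∀ j → j < n → length (filterᵇ (λ l → toℕ (proj₁ l) ≡ᵇ j) w) ≡ 1
  onceEach j j<n = subst (λ t → length (filterᵇ (λ l → toℕ (proj₁ l) ≡ᵇ t) w) ≡ 1) (toℕ-fromℕ< j<N)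
                         (once (Fin.fromℕ< j<N) (subst (_< n) (sym (toℕ-fromℕ< j<N)) j<n))
    where
    j<N : j < N
    j<N = ℕ.<-≤-trans j<n n≤N
  cardsBelow-≤ : ∀ k → k ≤ n → cardsBelow k w ≡ k
  cardsBelow-≤ zero    _   = ∑-zero (λ _ → refl) w
  cardsBelow-≤ (suc k) k<n = trans (cardsBelow-suc k w)
    (trans (cong₂ _+_ (cardsBelow-≤ k (ℕ.<⇒≤ k<n)) (onceEach k k<n)) (ℕ.+-comm k 1))

-- Probabilities

-- i / suc k is fromℚᵘ (mkℚᵘ i k), so identities between fractions reduce in ℚᵘ to ring
-- identities in ℤ.
toℚᵘ-/ : ∀ i k → toℚᵘ (i ℚ./ suc k) ≃ᵘ mkℚᵘ i k
toℚᵘ-/ i k = ℚ.toℚᵘ-fromℚᵘ (mkℚᵘ i k)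

j/A+k/A≡[j+k]/A : ∀ A .{{_ : NonZero A}} j k → (ℤ.+ j) ℚ./ A ℚ.+ (ℤ.+ k) ℚ./ A ≡ (ℤ.+ (j + k)) ℚ./ A
j/A+k/A≡[j+k]/A (suc A) j k = ℚ.toℚᵘ-injective (begin
  toℚᵘ ((ℤ.+ j) ℚ./ suc A ℚ.+ (ℤ.+ k) ℚ./ suc A)
    ≈⟨ ℚ.toℚᵘ-homo-+ ((ℤ.+ j) ℚ./ suc A) ((ℤ.+ k) ℚ./ suc A) ⟩
  toℚᵘ ((ℤ.+ j) ℚ./ suc A) ℚᵘ.+ toℚᵘ ((ℤ.+ k) ℚ./ suc A)
    ≈⟨ ℚᵘ.+-cong (toℚᵘ-/ (ℤ.+ j) A) (toℚᵘ-/ (ℤ.+ k) A) ⟩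
  mkℚᵘ (ℤ.+ j) A ℚᵘ.+ mkℚᵘ (ℤ.+ k) A
    ≈⟨ *≡* (trans (factor (ℤ.+ j) (ℤ.+ k) (ℤ.+ suc A)) (cong (ℤ._* (ℤ.+ suc A ℤ.* ℤ.+ suc A)) (sym (ℤ.pos-+ j k)))) ⟩
  mkℚᵘ (ℤ.+ (j + k)) A
    ≈⟨ ℚᵘ.≃-sym (toℚᵘ-/ (ℤ.+ (j + k)) A) ⟩
  toℚᵘ ((ℤ.+ (j + k)) ℚ./ suc A)
    ∎)
  where
  open ℚᵘ.≃-Reasoning
  factor : ∀ j k s → (j ℤ.* s ℤ.+ k ℤ.* s) ℤ.* s ≡ (j ℤ.+ k) ℤ.* (s ℤ.* s)
  factor = ℤSolver.solve-∀

1/A*F/P*1/L≡1/A : ∀ A P L .{{_ : NonZero A}} .{{_ : NonZero P}} .{{_ : NonZero L}} F → L * P ≡ F →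
  ((ℤ.+ 1) ℚ./ A ℚ.* ((ℤ.+ F) ℚ./ P)) ℚ.* ((ℤ.+ 1) ℚ./ L) ≡ (ℤ.+ 1) ℚ./ A
1/A*F/P*1/L≡1/A (suc A) (suc P) (suc L) F refl = ℚ.toℚᵘ-injective (begin
  toℚᵘ ((1/A ℚ.* F/P) ℚ.* 1/L)
    ≈⟨ ℚ.toℚᵘ-homo-* (1/A ℚ.* F/P) 1/L ⟩
  toℚᵘ (1/A ℚ.* F/P) ℚᵘ.* toℚᵘ 1/L
    ≈⟨ ℚᵘ.*-congʳ (ℚ.toℚᵘ-homo-* 1/A F/P) ⟩
  (toℚᵘ 1/A ℚᵘ.* toℚᵘ F/P) ℚᵘ.* toℚᵘ 1/L
    ≈⟨ ℚᵘ.*-cong (ℚᵘ.*-cong (toℚᵘ-/ (ℤ.+ 1) A) (toℚᵘ-/ (ℤ.+ F) P)) (toℚᵘ-/ (ℤ.+ 1) L) ⟩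
  (mkℚᵘ (ℤ.+ 1) A ℚᵘ.* mkℚᵘ (ℤ.+ F) P) ℚᵘ.* mkℚᵘ (ℤ.+ 1) L
    ≈⟨ *≡* (cancel (ℤ.+ suc A) (ℤ.+ suc P) (ℤ.+ suc L)) ⟩
  mkℚᵘ (ℤ.+ 1) A
    ≈⟨ ℚᵘ.≃-sym (toℚᵘ-/ (ℤ.+ 1) A) ⟩
  toℚᵘ 1/A
    ∎)
  where
  open ℚᵘ.≃-Reasoning
  1/A F/P 1/L : ℚ
  1/A = (ℤ.+ 1) ℚ./ suc A
  F/P = (ℤ.+ F) ℚ./ suc P
  1/L = (ℤ.+ 1) ℚ./ suc L
  cancel : ∀ a p l → ((ℤ.+ 1 ℤ.* (l ℤ.* p)) ℤ.* ℤ.+ 1) ℤ.* a ≡ ℤ.+ 1 ℤ.* ((a ℤ.* p) ℤ.* l)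
  cancel = ℤSolver.solve-∀

probOf-++ : ∀ {N} (D E : Dist (Word N)) y → probOf (D ++ E) y ≡ probOf D y ℚ.+ probOf E y
probOf-++ []      E y = sym (ℚ.+-identityˡ (probOf E y))
probOf-++ (p ∷ D) E y = trans (cong (pᵧ ℚ.+_) (probOf-++ D E y)) (sym (ℚ.+-assoc pᵧ (probOf D y) (probOf E y)))
  where
  pᵧ : ℚ
  pᵧ = if proj₁ p ≡W y then proj₂ p else 0ℚ

scaleBy : ∀ {A : Set} → ℚ → A × ℚ → A × ℚ
scaleBy c r = proj₁ r , c ℚ.* proj₂ r

module _ {N : ℕ} (y : Word N) (A : ℕ) .{{_ : NonZero A}} where

  probOf-constantWeight : ∀ c w → c ℚ.* w ≡ (ℤ.+ 1) ℚ./ A → (M : List (Word N)) →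
    probOf (map (scaleBy c) (map (λ z → z , w) M)) y ≡ (ℤ.+ coeff y M) ℚ./ A
  probOf-constantWeight c w cw≡1/A []       = sym (ℚ.0/n≡0 A)
  probOf-constantWeight c w cw≡1/A (z ∷ zs) with z ≡W y
  ... | true  = trans (cong₂ ℚ._+_ cw≡1/A (probOf-constantWeight c w cw≡1/A zs)) (j/A+k/A≡[j+k]/A A 1 (coeff y zs))
  ... | false = trans (ℚ.+-identityˡ _) (probOf-constantWeight c w cw≡1/A zs)

  probOf-uniform : ∀ (L : List (Word N)) P .{{_ : NonZero P}} F → length L * P ≡ F →
    probOf (map (scaleBy ((ℤ.+ 1) ℚ./ A ℚ.* ((ℤ.+ F) ℚ./ P))) (uniform L)) y ≡ (ℤ.+ coeff y L) ℚ./ A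
  probOf-uniform []       P F _     = sym (ℚ.0/n≡0 A)
  probOf-uniform (z ∷ zs) P F |L|*P≡F =
    probOf-constantWeight ((ℤ.+ 1) ℚ./ A ℚ.* ((ℤ.+ F) ℚ./ P)) ((ℤ.+ 1) ℚ./ suc (length zs))
                          (1/A*F/P*1/L≡1/A A P (suc (length zs)) F |L|*P≡F) (z ∷ zs)

module _ {N : ℕ} (y : Word N) (n a : ℕ) .{{_ : NonZero a}} where
  private instance
    aⁿ≢0 : NonZero (a ^ n)
    aⁿ≢0 = ℕ.m^n≢0 a n

  probOf-compositionMixture : (L : Vec ℕ a → List (Word N)) (W : List (Vec ℕ a)) →
    All (λ d → length (L d) * prodFact d ≡ n !) W →
    probOf (concatMap (λ d → map (scaleBy (compProb n a d)) (uniform (L d))) W) y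
      ≡ (ℤ.+ ∑ (λ d → coeff y (L d)) W) ℚ./ a ^ n
  probOf-compositionMixture L []      []               = sym (ℚ.0/n≡0 (a ^ n))
  probOf-compositionMixture L (d ∷ W) (|Ld|*d!≡n! ∷ rest) = begin
    probOf (map (scaleBy (compProb n a d)) (uniform (L d)) ++ mixture W) y
      ≡⟨ probOf-++ (map (scaleBy (compProb n a d)) (uniform (L d))) (mixture W) y ⟩
    probOf (map (scaleBy (compProb n a d)) (uniform (L d))) y ℚ.+ probOf (mixture W) y
      ≡⟨ cong₂ ℚ._+_ (probOf-uniform y (a ^ n) (L d) (prodFact d) {{prodFact-nz d}} (n !) |Ld|*d!≡n!)
                     (probOf-compositionMixture L W rest) ⟩
    (ℤ.+ coeff y (L d)) ℚ./ a ^ n ℚ.+ (ℤ.+ ∑ (λ d → coeff y (L d)) W) ℚ./ a ^ n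
      ≡⟨ j/A+k/A≡[j+k]/A (a ^ n) (coeff y (L d)) _ ⟩
    (ℤ.+ ∑ (λ d → coeff y (L d)) (d ∷ W)) ℚ./ a ^ n
      ∎
    where
    open ≡-Reasoning
    mixture : List (Vec ℕ a) → Dist (Word N)
    mixture = concatMap (λ d → map (scaleBy (compProb n a d)) (uniform (L d)))

-- The coefficients of θ^±_a(x)

shuffleOutcomes : ∀ {N a} → Orient → Piles → ℕ → Word N → Vec ℕ a → List (Word N)
shuffleOutcomes o p n x d = map (merge (transformPiles p (θ o) (cut x d))) (interleavings n d)

module _ {N a} (o : Orient) (p : Piles) {n} (x : Word N) (|x|≡n : length x ≡ n) (d : Vec ℕ a) (Σd≡n : Vec.sum d ≡ n) where

  private
    piles : Vec (Word N) a
    piles = altMap (selected p 0) (θ o) (cut x d)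

    lengths-piles : lengths piles ≡ d
    lengths-piles = trans (lengths-altMap (selected p 0) (θ o) (θ-length o) (cut x d))
                          (lengths-cut x d (ℕ.≤-reflexive (trans Σd≡n (sym |x|≡n))))

  ∑-shuffleOutcomes : (h : Word N → ℕ) → ∑ h (shuffleOutcomes o p n x d) ≡ ∑ h (mProd piles)
  ∑-shuffleOutcomes h = begin
    ∑ h (map (merge (transformPiles p (θ o) (cut x d))) (interleavings n d))
      ≡⟨ cong (λ ps → ∑ h (map (merge ps) (interleavings n d))) (sym (altMap-transformPiles p (θ o) (cut x d))) ⟩
    ∑ h (map (merge piles) (interleavings n d))
      ≡⟨ cong (λ d′ → ∑ h (map (merge piles) (interleavings n d′))) (sym lengths-piles) ⟩
    ∑ h (map (merge piles) (interleavings n (lengths piles)))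
      ≡⟨ ∑-merge-interleavings n piles h (trans (cong Vec.sum lengths-piles) Σd≡n) ⟩
    ∑ h (mProd piles)
      ∎
    where open ≡-Reasoning

  length-shuffleOutcomes : length (shuffleOutcomes o p n x d) * prodFact d ≡ n !
  length-shuffleOutcomes = begin
    length (shuffleOutcomes o p n x d) * prodFact d
      ≡⟨ cong₂ _*_ sameLength (cong prodFact (sym lengths-piles)) ⟩
    length (mProd piles) * prodFact (lengths piles)
      ≡⟨ length-mProd piles ⟩
    Vec.sum (lengths piles) !
      ≡⟨ cong (λ d′ → Vec.sum d′ !) lengths-piles ⟩
    Vec.sum d !
      ≡⟨ cong _! Σd≡n ⟩
    n !
      ∎
    where
    open ≡-Reasoning
    sameLength : length (shuffleOutcomes o p n x d) ≡ length (mProd piles)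
    sameLength = trans (length≡∑1 (shuffleOutcomes o p n x d))
                 (trans (∑-shuffleOutcomes (λ _ → 1)) (sym (length≡∑1 (mProd piles))))

All-weakComps : ∀ a n → All (λ d → Vec.sum d ≡ n) (weakComps a n)
All-weakComps a n = All.map (ℕ.≡ᵇ⇒≡ _ n) (All.all-filter (λ d → T? (Vec.sum d ≡ᵇ n)) (allVecs a n))

∑-θPow : ∀ {N} o s a {n} (x : Word N) → length x ≡ n → (h : Word N → ℕ) →
  ∑ h (θPow o s a x) ≡ ∑ (λ d → ∑ h (shuffleOutcomes o (pilesOf s) n x d)) (weakComps a n)
∑-θPow o s a {n} x |x|≡n h = begin
  ∑ h (concatMap (λ v → mProd (altMap (startsWithθ s) (θ o) v)) (deconcat a x))
    ≡⟨ ∑-concatMap h (mProd ∘ altMap (startsWithθ s) (θ o)) (deconcat a x) ⟩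
  ∑ G (deconcat a x)
    ≡⟨ ∑-deconcat a x n G (ℕ.≤-reflexive |x|≡n) ⟩
  ∑ (λ d → if Vec.sum d ≡ᵇ length x then G (cut x d) else 0) (allVecs a n)
    ≡⟨ ∑-cong (λ d → cong (λ m → if Vec.sum d ≡ᵇ m then G (cut x d) else 0) |x|≡n) (allVecs a n) ⟩
  ∑ (λ d → if Vec.sum d ≡ᵇ n then G (cut x d) else 0) (allVecs a n)
    ≡⟨ sym (∑-filterᵇ (G ∘ cut x) (λ d → Vec.sum d ≡ᵇ n) (allVecs a n)) ⟩
  ∑ (G ∘ cut x) (weakComps a n)
    ≡⟨ ∑-cong-All (All.map (λ {d} Σd≡n → trans (cong (λ b → ∑ h (mProd (altMap b (θ o) (cut x d)))) (startsWithθ≡selected-0 s))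
                                                (sym (∑-shuffleOutcomes o (pilesOf s) x |x|≡n d Σd≡n h)))
                           (All-weakComps a n)) ⟩
  ∑ (λ d → ∑ h (shuffleOutcomes o (pilesOf s) n x d)) (weakComps a n)
    ∎
  where
  open ≡-Reasoning
  G : Vec (Word _) a → ℕ
  G v = ∑ h (mProd (altMap (startsWithθ s) (θ o) v))

coeff-θPow : ∀ {N} o s a {n} (x y : Word N) → length x ≡ n →
  coeff y (θPow o s a x) ≡ ∑ (λ d → coeff y (shuffleOutcomes o (pilesOf s) n x d)) (weakComps a n)
coeff-θPow o s a {n} x y |x|≡n =
  trans (length-filterᵇ (_≡W y) (θPow o s a x))
  (trans (∑-θPow o s a x |x|≡n (λ w → if w ≡W y then 1 else 0))
         (∑-cong (λ d → sym (length-filterᵇ (_≡W y) (shuffleOutcomes o (pilesOf s) n x d))) (weakComps a n)))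

corollary5p1 : (N n a : ℕ) .{{_ : NonZero a}} → 1 ≤ n → n ≤ N →
    (o : Orient) (s : Sign) (x y : Word N) → IsSignedPerm n x → IsSignedPerm n y →
    K o s n a x y ≡ shuffleProb o (pilesOf s) n a x y
corollary5p1 N n a _ n≤N o s x y x-perm _ = begin
  K o s n a x y
    ≡⟨ cong (λ k → (ℤ.+ k) ℚ./ a ^ n) (coeff-θPow o s a x y |x|≡n) ⟩
  (ℤ.+ ∑ (λ d → coeff y (outcomes d)) (weakComps a n)) ℚ./ a ^ n
    ≡⟨ sym (probOf-compositionMixture y n a outcomes (weakComps a n) (All.map (λ {d} → counted {d}) (All-weakComps a n))) ⟩
  shuffleProb o (pilesOf s) n a x y
    ∎
  where
  open ≡-Reasoning
  instance
    aⁿ≢0 : NonZero (a ^ n)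
    aⁿ≢0 = ℕ.m^n≢0 a n
  |x|≡n : length x ≡ n
  |x|≡n = IsSignedPerm-length n x n≤N x-perm
  outcomes : Vec ℕ a → List (Word N)
  outcomes = shuffleOutcomes o (pilesOf s) n x
  counted : ∀ {d} → Vec.sum d ≡ n → length (outcomes d) * prodFact d ≡ n !
  counted {d} = length-shuffleOutcomes o (pilesOf s) x |x|≡n d
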